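{- For an arbitrary set $A\subseteq\mathbb{N}$ there exists a uniform total function $f\colon\mathbb{N}\to\mathbb{N}$ that reduces $A$ to the set of even numbers, i.e., $f(x)$ is even for every $x\in A$ and $f(x)$ is odd for every $x\notin A$.
   Context: For $A\subseteq \mathbb{N}$ and $n\ge 1$, $\rho_n(A) = \#\{k<n \mid k\in A\}/n$. A set $A$ is negligible if $\lim_n \rho_n(A)=0$. A total function $f\colon\mathbb{N}\to\mathbb{N}$ is uniform if $f^{ -1}(S)$ is negligible for every negligible $S\subseteq\mathbb{N}$. -}

module Defs where

open import Data.Bool using (Bool; true; false; if_then_else_)
open import Data.Nat using (ℕ; zero; suc; _+_; _≤_)
open import Data.Integer using (+_)
open import Data.Rational.Unnormalised using (ℚᵘ; mkℚᵘ; 0ℚᵘ; _<_)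
open import Data.Product using (∃)

Subset : Set
Subset = ℕ → Bool

count : Subset → ℕ → ℕ
count A zero    = 0
count A (suc n) = count A n + (if A n then 1 else 0)

-- ρ-suc A m = ρ_{m+1}(A) = count A (m+1) / (m+1)   (ρ_n is only defined for n ≥ 1)
ρ-suc : Subset → ℕ → ℚᵘ
ρ-suc A m = mkℚᵘ (+ count A (suc m)) m

-- lim_n ρ_n(A) = 0  (ρ_n ≥ 0, so |ρ_n - 0| = ρ_n)
Negligible : Subset → Set
Negligible A = ∀ (ε : ℚᵘ) → 0ℚᵘ < ε → ∃ λ N → ∀ m → N ≤ m → ρ-suc A m < ε

Uniform : (ℕ → ℕ) → Set
Uniform f = ∀ (S : Subset) → Negligible S → Negligible (λ x → S (f x))

module Submission where

-- Every set A ⊆ ℕ reduces to the even numbers by the uniform map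
--   f x = 2x      if x ∈ A,
--   f x = 2x + 1  if x ∉ A.
--
-- Uniformity rests on two general facts, established first.
--   * Dilation criterion: if #{x < n ∣ f x ∈ S} ≤ #{y < k n ∣ y ∈ S} for all S and n,
--     then ρ_n(f⁻¹ S) ≤ k · ρ_{kn}(S), so f⁻¹ preserves negligibility (given ε, use ε/k
--     for S).

open import Defs
open import Algebra.Properties.CommutativeSemigroup using (x∙yz≈y∙xz)
open import Data.Bool using (true; false; if_then_else_)
open import Data.Integer using (+_; -[1+_]; +<+)
import Data.Integer as ℤ
import Data.Integer.Properties as ℤ
open import Data.Nat using (ℕ; zero; suc; _+_; _*_; _≤_; z≤n)
import Data.Nat as ℕ
open import Data.Nat.Divisibility using (_∣_; divides)
open import Data.Nat.Properties
open import Data.Product using (∃; _×_; _,_; proj₁; proj₂)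
open import Data.Rational.Unnormalised using (mkℚᵘ; 0ℚᵘ; *<*)
import Data.Rational.Unnormalised as ℚᵘ
open import Data.Rational.Unnormalised.Properties using (drop-*<*)
open import Data.Sum using (_⊎_; inj₁; inj₂)
open import Relation.Binary.PropositionalEquality using (_≡_; refl; sym; trans; cong; subst₂)
open import Relation.Nullary using (¬_)

<⇒cross : ∀ {a b c d} → mkℚᵘ (+ a) b ℚᵘ.< mkℚᵘ (+ c) d → a * suc d ℕ.< c * suc b
<⇒cross {a} {b} {c} {d} h =
  ℤ.drop‿+<+ (subst₂ ℤ._<_ (sym (ℤ.pos-* a (suc d))) (sym (ℤ.pos-* c (suc b))) (drop-*<* h))

cross⇒< : ∀ {a b c d} → a * suc d ℕ.< c * suc b → mkℚᵘ (+ a) b ℚᵘ.< mkℚᵘ (+ c) d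
cross⇒< {a} {b} {c} {d} h = *<* (subst₂ ℤ._<_ (ℤ.pos-* a (suc d)) (ℤ.pos-* c (suc b)) (+<+ h))

cancel-common-factor : ∀ k {c c′ p a b} → c ≤ c′ → c′ * (k * a) ℕ.< p * (k * b) → c * a ℕ.< p * b
cancel-common-factor k {c} {c′} {p} {a} {b} c≤c′ h = *-cancelˡ-< k _ _ (begin-strict
  k * (c * a)    ≤⟨ *-monoʳ-≤ k (*-monoˡ-≤ a c≤c′) ⟩
  k * (c′ * a)   ≡⟨ swap k c′ a ⟩
  c′ * (k * a)   <⟨ h ⟩
  p * (k * b)    ≡⟨ swap p k b ⟩
  k * (p * b)    ∎)
  where
  open ≤-Reasoning
  swap : ∀ x y z → x * (y * z) ≡ y * (x * z)
  swap = x∙yz≈y∙xz *-commutativeSemigroup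

-- Dilation criterion: if the preimage f⁻¹ S is at most as dense on [0, n) as S itself is
-- on [0, k n) (here k = 1 + j), then f is uniform, since ρ_n(f⁻¹ S) ≤ k · ρ_{kn}(S).
dilation⇒uniform : ∀ j (f : ℕ → ℕ) →
                   (∀ S n → count (λ x → S (f x)) n ≤ count S (suc j * n)) → Uniform f
dilation⇒uniform j f dominated S negligible (mkℚᵘ (+ p) q) ε>0 = N , bound
  where
  -- ε/k = p / (k (q + 1)), still positive.
  ε/k>0 : 0ℚᵘ ℚᵘ.< mkℚᵘ (+ p) (q + j * suc q)
  ε/k>0 = cross⇒< (<⇒cross ε>0)

  N : ℕ
  N = proj₁ (negligible _ ε/k>0)

  bound : ∀ m → N ≤ m → ρ-suc (λ x → S (f x)) m ℚᵘ.< mkℚᵘ (+ p) q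
  bound m N≤m = cross⇒< (cancel-common-factor (suc j) {p = p} {b = suc m} (dominated S (suc m)) S-sparse)
    where
    -- S has density below ε/k on [0, k (m + 1)), since k (m + 1) - 1 ≥ m ≥ N.
    S-sparse : count S (suc j * suc m) * (suc j * suc q) ℕ.< p * (suc j * suc m)
    S-sparse = <⇒cross (proj₂ (negligible _ ε/k>0) (m + j * suc m) (≤-trans N≤m (m≤m+n m _)))
dilation⇒uniform j f dominated S negligible (mkℚᵘ -[1+ p ] q) (*<* ())

InDoubledBlock : (ℕ → ℕ) → Set
InDoubledBlock f = ∀ x → f x ≡ 2 * x ⊎ f x ≡ suc (2 * x)

indicator-≤-block : ∀ (S : Subset) {y} n → y ≡ 2 * n ⊎ y ≡ suc (2 * n) →
                    (if S y then 1 else 0) ≤ (if S (2 * n) then 1 else 0) + (if S (suc (2 * n)) then 1 else 0)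
indicator-≤-block S n (inj₁ refl) = m≤m+n _ _
indicator-≤-block S n (inj₂ refl) = m≤n+m _ _

count-preimage-≤ : ∀ f → InDoubledBlock f → ∀ S n → count (λ x → S (f x)) n ≤ count S (2 * n)
count-preimage-≤ f inBlock S zero    = z≤n
count-preimage-≤ f inBlock S (suc n) = begin
  count (λ x → S (f x)) n + (if S (f n) then 1 else 0)
    ≤⟨ +-mono-≤ (count-preimage-≤ f inBlock S n) (indicator-≤-block S n (inBlock n)) ⟩
  count S (2 * n) + ((if S (2 * n) then 1 else 0) + (if S (suc (2 * n)) then 1 else 0))
    ≡⟨ sym (+-assoc (count S (2 * n)) _ _) ⟩
  count S (2 + 2 * n)
    ≡⟨ cong (count S) (sym (*-suc 2 n)) ⟩
  count S (2 * suc n) ∎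
  where open ≤-Reasoning

parity-code : Subset → ℕ → ℕ
parity-code A x = if A x then 2 * x else suc (2 * x)

parity-code-in-block : ∀ A → InDoubledBlock (parity-code A)
parity-code-in-block A x with A x
... | true  = inj₁ refl
... | false = inj₂ refl

even-double : ∀ x → 2 ∣ 2 * x
even-double x = divides x (*-comm 2 x)

odd-not-even : ∀ x → ¬ (2 ∣ suc (2 * x))
odd-not-even x (divides q odd≡q*2) = even≢odd q x (sym (trans odd≡q*2 (*-comm q 2)))

lemma1 : (A : Subset) → ∃ λ (f : ℕ → ℕ) → Uniform f × (∀ x → A x ≡ true → 2 ∣ f x) × (∀ x → A x ≡ false → ¬ (2 ∣ f x))
lemma1 A = parity-code A , uniform , members-even , non-members-odd
  where
  uniform : Uniform (parity-code A)
  uniform = dilation⇒uniform 1 (parity-code A) (count-preimage-≤ (parity-code A) (parity-code-in-block A))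

  members-even : ∀ x → A x ≡ true → 2 ∣ parity-code A x
  members-even x x∈A rewrite x∈A = even-double x

  non-members-odd : ∀ x → A x ≡ false → ¬ (2 ∣ parity-code A x)
  non-members-odd x x∉A rewrite x∉A = odd-not-even x
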